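{- For every sequence $(\xi_i)_{i\in\mathbb N}$ of terms in $\Lambda$ there exists $\phi\in\Lambda$ such that: (a) $\phi\underline i\succ\xi_i$ for every $i\in\mathbb N$; and (b) for every $U\in\Lambda$ such that $U\phi\Vdash\bot$, there exists $k\in\mathbb N$ such that $U\psi\Vdash\bot$ for every $\psi\in\Lambda$ satisfying $\psi\underline i\succ\xi_i$ for all $i<k$.
   Context: Fix an integer $N\ge 0$. The BBC realizability algebra $(\Lambda,\Pi,\perp\!\!\!\perp)$: terms $\Lambda$ form the smallest set containing constants $\mathsf B,\mathsf C,\mathsf I,\mathsf K,\mathsf W,\mathsf{cc},\mathsf A$ and $\mathsf p,\mathsf q_0,\dots,\mathsf q_N$, closed under application $(\xi)\eta$, and such that to every sequence $(\xi_i)_{i\in\mathbb N}$ of closed terms (no occurrence of $\mathsf p,\mathsf q_0,\dots,\mathsf q_N$) is associated injectively and well-foundedly a new constant $\bigwedge_i\xi_i$. Stacks: $t_0\cdot\ldots\cdot t_{n-1}\cdot\pi_0$, $\pi_0$ the empty stack. Continuations $\mathsf k_{\pi_0}=\mathsf A$, $\mathsf k_{t\cdot\pi}=(\ell_t)\mathsf k_\pi$, $\ell_t=((\mathsf C)(\mathsf B)\mathsf C\mathsf B)t$; integers $\underline 0=(\mathsf K)\mathsf I$, $\underline{n+1}=(\sigma)\underline n$, $\sigma=(\mathsf B\mathsf W)(\mathsf C)(\mathsf B)\mathsf B\mathsf B$. Execution $\succ$: least preorder with $(\xi)\eta\star\pi\succ\xi\star\eta\cdot\pi$; $\mathsf B\star\xi\cdot\eta\cdot\zeta\cdot\pi\succ\xi\star(\eta)\zeta\cdot\pi$;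 $\mathsf C\star\xi\cdot\eta\cdot\zeta\cdot\pi\succ\xi\star\zeta\cdot\eta\cdot\pi$; $\mathsf I\star\xi\cdot\pi\succ\xi\star\pi$; $\mathsf K\star\xi\cdot\eta\cdot\pi\succ\xi\star\pi$; $\mathsf W\star\xi\cdot\eta\cdot\pi\succ\xi\star\eta\cdot\eta\cdot\pi$; $\mathsf{cc}\star\xi\cdot\pi\succ\xi\star\mathsf k_\pi\cdot\pi$; $\mathsf A\star\xi\cdot\pi\succ\xi\star\pi_0$; $\bigwedge_i\xi_i\star\underline n\cdot\pi\succ\xi_n\star\pi$. For terms, $\xi\succ\eta$ means $\xi\star\pi\succ\eta\star\pi$ for every stack $\pi$. Pole $\perp\!\!\!\perp=\{\xi\star\pi:\exists\varpi,\ \xi\star\pi\succ\mathsf p\star\varpi\}$. $\xi\Vdash\bot$ means $\xi\star\pi\in\perp\!\!\!\perp$ for every stack $\pi$. -}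

module Defs where

open import Data.Nat using (ℕ; zero; suc; _<_)
open import Data.Fin using (Fin)
open import Data.Bool using (Bool; true; false)
open import Data.List using (List; []; _∷_)
open import Data.Product using (_×_; _,_; ∃)
open import Relation.Binary.Construct.Closure.ReflexiveTransitive using (Star)

-- Terms of the BBC realizability algebra, parametrised by N (the constants
-- q_0 .. q_N are indexed by Fin (suc N)).  The Bool index says whether the
-- term may contain p, q_0..q_N (true) or is closed (false).  The infinitary
-- constant ⋀ takes a sequence of closed terms; as a constructor it is
-- injective and the inductive type is well-founded.
data Tm (N : ℕ) : Bool → Set where
  B C I K W cc A : ∀ {b} → Tm N b
  p : Tm N true
  q : Fin (suc N) → Tm N true
  _·_ : ∀ {b} → Tm N b → Tm N b → Tm N b
  ⋀ : ∀ {b} → (ℕ → Tm N false) → Tm N b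

infixl 9 _·_

Λ : ℕ → Set
Λ N = Tm N true

emb : ∀ {N b} → Tm N false → Tm N b
emb B = B
emb C = C
emb I = I
emb K = K
emb W = W
emb cc = cc
emb A = A
emb (t · u) = emb t · emb u
emb (⋀ f) = ⋀ f

-- Stacks t_0 · ... · t_{n-1} · π_0
Stack : ℕ → Set
Stack N = List (Λ N)

ℓ : ∀ {N} → Λ N → Λ N
ℓ t = C · (B · C · B) · t

kont : ∀ {N} → Stack N → Λ N
kont [] = A
kont (t ∷ π) = ℓ t · kont π

σ : ∀ {N} → Λ N
σ = B · W · (C · (B · B · B))

num : ∀ {N} → ℕ → Λ N
num zero = K · I
num (suc n) = σ · num n

Process : ℕ → Set
Process N = Λ N × Stack N

data _⟶_ {N : ℕ} : Process N → Process N → Set where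
  push : ∀ {ξ η π} → (ξ · η , π) ⟶ (ξ , η ∷ π)
  stepB : ∀ {ξ η ζ π} → (B , ξ ∷ η ∷ ζ ∷ π) ⟶ (ξ , (η · ζ) ∷ π)
  stepC : ∀ {ξ η ζ π} → (C , ξ ∷ η ∷ ζ ∷ π) ⟶ (ξ , ζ ∷ η ∷ π)
  stepI : ∀ {ξ π} → (I , ξ ∷ π) ⟶ (ξ , π)
  stepK : ∀ {ξ η π} → (K , ξ ∷ η ∷ π) ⟶ (ξ , π)
  stepW : ∀ {ξ η π} → (W , ξ ∷ η ∷ π) ⟶ (ξ , η ∷ η ∷ π)
  stepcc : ∀ {ξ π} → (cc , ξ ∷ π) ⟶ (ξ , kont π ∷ π)
  stepA : ∀ {ξ π} → (A , ξ ∷ π) ⟶ (ξ , [])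
  step⋀ : ∀ {f n π} → (⋀ f , num n ∷ π) ⟶ (emb (f n) , π)

_≻_ : ∀ {N} → Process N → Process N → Set
_≻_ = Star _⟶_

_≻ₜ_ : ∀ {N} → Λ N → Λ N → Set
_≻ₜ_ {N} ξ η = ∀ (π : Stack N) → (ξ , π) ≻ (η , π)

Pole : ∀ {N} → Process N → Set
Pole {N} P = ∃ λ (ϖ : Stack N) → P ≻ (p , ϖ)

_⊩⊥ : ∀ {N} → Λ N → Set
_⊩⊥ {N} ξ = ∀ (π : Stack N) → Pole (ξ , π)

module Submission where

-- The terms ξ i may contain the constants p, q_0 .. q_N, so they
-- cannot be fed to ⋀ directly.  Combinatory completeness of B, C, I, K, W
-- (a continuation-passing bracket abstraction) turns each ξ i into a closed
-- term f i with  f i ⋆ q_N · … · q_0 · p · π ≻ ξ i ⋆ π, and φ is ⋀ f preceded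
-- by a wrapper that pushes these atoms under its first argument; this gives
-- (a).  For (b), fix one run of  U φ ⋆ π₀  reaching p and let k be its
-- weight: the sum of n + 1 over its steps  ⋀ ⋆ n · π.  Since execution is
-- deterministic, every run of φ reaching p starts by consuming a numeral n
-- and continues as a run of ξ n of smaller weight (inversion of φ).
-- Replacing φ by ψ, and A by the continuation of an arbitrary stack π, gives
-- a simulation of the fixed run: where it calls φ on n < k, ψ n reduces to
-- ξ n by hypothesis, and every other step is mimicked literally; so U ψ ⋆ π
-- reaches p.  The file develops, in order: runs, determinism and saturation
-- of the pole; numerals and continuations; bracket abstraction; construction
-- and inversion of φ; the simulation; the theorem.

open import Defs
open import Data.Nat using (ℕ; zero; suc; _<_; _≤_; _+_; s≤s)
open import Data.Nat.Properties using (≤-pred; ≤-trans; ≤-refl; m≤n+m; m≤n⇒m≤1+n; m+n≤o⇒m≤o; m+n≤o⇒n≤o; +-monoʳ-≤; ≤-reflexive)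
open import Data.Bool using (false)
open import Data.Fin using (Fin; zero; suc)
open import Data.Vec.Functional using (Vector; head; tail)
open import Data.List using ([]; _∷_; _++_; foldl)
open import Data.List.Properties using (++-identityʳ)
open import Data.Product using (Σ; ∃; _×_; _,_; proj₁; proj₂)
open import Data.Empty using (⊥; ⊥-elim)
open import Relation.Nullary using (¬_)
open import Relation.Binary.PropositionalEquality using (_≡_; refl; sym; cong; cong₂; subst)
open import Relation.Binary.Construct.Closure.ReflexiveTransitive using (ε; _◅_; _◅◅_)

-- The weight of a step is n + 1 for a ⋀-step on the numeral n and 0
-- otherwise; the weight of a run bounds every index ⋀ is applied to in it.
step-weight : ∀ {N} {P Q : Process N} → P ⟶ Q → ℕ
step-weight (step⋀ {n = n}) = suc n
step-weight _ = 0

weight : ∀ {N} {P Q : Process N} → P ≻ Q → ℕ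
weight ε = 0
weight (s ◅ d) = step-weight s + weight d

-- Numerals are pairwise distinct (needed for determinism of ⋀-steps).
num-injective : ∀ {N} {m n} → num {N} m ≡ num n → m ≡ n
num-injective {m = zero} {zero} _ = refl
num-injective {m = suc m} {suc n} eq = cong suc (num-injective (cong argument eq))
  where
  argument : ∀ {N} → Λ N → Λ N
  argument (_ · u) = u
  argument t = t

module _ {N : ℕ} where

  private
    sequence : Λ N → (ℕ → Tm N false)
    sequence (⋀ f) = f
    sequence _ = λ _ → B

    top : Stack N → Λ N
    top [] = A
    top (t ∷ _) = t

    pop : Stack N → Stack N
    pop [] = []
    pop (_ ∷ σ) = σ

  -- A ⋀-step is determined by the sequence, the numeral and the stack.
  -- (Stated with an equation because num is a function, not a constructor.)
  ⋀-step-unique : ∀ {P R : Process N} → P ⟶ R → ∀ {f n π} →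
                  P ≡ (⋀ f , num n ∷ π) → R ≡ (emb (f n) , π)
  ⋀-step-unique push ()
  ⋀-step-unique stepB ()
  ⋀-step-unique stepC ()
  ⋀-step-unique stepI ()
  ⋀-step-unique stepK ()
  ⋀-step-unique stepW ()
  ⋀-step-unique stepcc ()
  ⋀-step-unique stepA ()
  ⋀-step-unique step⋀ eq
    with cong (λ P → sequence (proj₁ P)) eq
       | num-injective (cong (λ P → top (proj₂ P)) eq)
       | cong (λ P → pop (proj₂ P)) eq
  ... | refl | refl | refl = refl

  deterministic : ∀ {P Q R : Process N} → P ⟶ Q → P ⟶ R → Q ≡ R
  deterministic push push = refl
  deterministic stepB stepB = refl
  deterministic stepC stepC = refl
  deterministic stepI stepI = refl
  deterministic stepK stepK = refl
  deterministic stepW stepW = refl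
  deterministic stepcc stepcc = refl
  deterministic stepA stepA = refl
  deterministic step⋀ s = sym (⋀-step-unique s refl)

  p-stuck : ∀ {ϖ : Stack N} {Q} → (p , ϖ) ⟶ Q → ⊥
  p-stuck ()

  -- By determinism, a run from P to p passes through every Q with P ≻ Q,
  -- and the part after Q weighs no more than the whole run.
  residual : ∀ {P Q : Process N} {ϖ} → P ≻ Q → (d : P ≻ (p , ϖ)) →
             Σ (Q ≻ (p , ϖ)) λ d' → weight d' ≤ weight d
  residual ε d = d , ≤-refl
  residual (s ◅ e) ε = ⊥-elim (p-stuck s)
  residual (s ◅ e) (s' ◅ d) with deterministic s s'
  ... | refl with residual e d
  ... | d' , w = d' , ≤-trans w (m≤n+m _ (step-weight s'))

  pole-forward : ∀ {P Q : Process N} → P ≻ Q → Pole P → Pole Q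
  pole-forward e (ϖ , d) = ϖ , proj₁ (residual e d)

  pole-backward : ∀ {P Q : Process N} → P ≻ Q → Pole Q → Pole P
  pole-backward e (ϖ , d) = ϖ , (e ◅◅ d)

data Pure {N : ℕ} : Λ N → Set where
  pB : Pure B
  pC : Pure C
  pI : Pure I
  pK : Pure K
  pW : Pure W
  p· : ∀ {t u} → Pure t → Pure u → Pure (t · u)

num-pure : ∀ {N} n → Pure {N} (num n)
num-pure zero = p· pK pI
num-pure (suc n) = p· (p· (p· pB pW) (p· pC (p· (p· pB pB) pB))) (num-pure n)

kont-run : ∀ {N} (ρ : Stack N) x τ → (kont ρ , x ∷ τ) ≻ (x , ρ)
kont-run ρ x τ = collect ρ x τ ◅◅ subst (λ σ → (foldl _·_ x ρ , []) ≻ (x , σ)) (++-identityʳ ρ) (unfold ρ x [])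
  where
  -- k_ρ applies x to the elements of ρ one by one, then A empties the stack
  collect : ∀ {N} (ρ : Stack N) x τ → (kont ρ , x ∷ τ) ≻ (foldl _·_ x ρ , [])
  collect [] x τ = stepA ◅ ε
  collect (t ∷ ρ) x τ =
    push ◅ push ◅ push ◅ stepC ◅ push ◅ push ◅ stepB ◅ stepC ◅ push ◅ stepB ◅ collect ρ (x · t) τ
  unfold : ∀ {N} (ρ : Stack N) x σ → (foldl _·_ x ρ , σ) ≻ (x , ρ ++ σ)
  unfold [] x σ = ε
  unfold (t ∷ ρ) x σ = unfold ρ (x · t) σ ◅◅ (push ◅ ε)

data Open (N M : ℕ) : Set where
  var : Fin M → Open N M
  con : Tm N false → Open N M
  _∙_ : Open N M → Open N M → Open N M

infixl 9 _∙_

⟦_⟧ : ∀ {N M} → Open N M → Vector (Λ N) M → Λ N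
⟦ var j ⟧ e = e j
⟦ con c ⟧ e = emb c
⟦ s ∙ t ⟧ e = ⟦ s ⟧ e · ⟦ t ⟧ e

closed : ∀ {N} → Open N 0 → Tm N false
closed (var ())
closed (con c) = c
closed (s ∙ t) = closed s · closed t

emb-closed : ∀ {N} (s : Open N 0) (e : Vector (Λ N) 0) → emb (closed s) ≡ ⟦ s ⟧ e
emb-closed (var ()) e
emb-closed (con c) e = refl
emb-closed (s ∙ t) e = cong₂ _·_ (emb-closed s e) (emb-closed t e)

constantly : ∀ {N M} → Open N M → Open N M
constantly t = con C ∙ (con K ∙ (con C ∙ con I ∙ t))

constantly-run : ∀ {N} (t k x : Λ N) σ → (C · (K · (C · I · t)) , k ∷ x ∷ σ) ≻ (k , t ∷ σ)
constantly-run t k x σ = push ◅ stepC ◅ push ◅ stepK ◅ push ◅ push ◅ stepC ◅ stepI ◅ ε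

-- The continuation k is needed because the machine never reduces inside the
-- stack, so s[x] must be assembled by the code itself.
λ* : ∀ {N M} → Open N (suc M) → Open N M
λ* (var zero) = con I
λ* (var (suc j)) = constantly (var j)
λ* (con c) = constantly (con c)
λ* (u ∙ v) = con B ∙ con W ∙ (con B ∙ (con B ∙ λ* u) ∙ (con B ∙ con C ∙ (con B ∙ (con B ∙ λ* v) ∙ con B)))

-- For an application:  λ*(u v) ⋆ k · x · σ  duplicates x (W) and runs  λ* u
-- with continuation  (BC(B(B λ*v)B)) k x, which runs  λ* v  with continuation
-- B k u[x];  finally  B k u[x] ⋆ v[x] · σ ≻ k ⋆ u[x] v[x] · σ.
λ*-run : ∀ {N M} (s : Open N (suc M)) (e : Vector (Λ N) (suc M)) (k : Λ N) σ →
         (⟦ λ* s ⟧ (tail e) , k ∷ head e ∷ σ) ≻ (k , ⟦ s ⟧ e ∷ σ)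
λ*-run (var zero) e k σ = stepI ◅ ε
λ*-run (var (suc j)) e k σ = constantly-run (e (suc j)) k (head e) σ
λ*-run (con c) e k σ = constantly-run (emb c) k (head e) σ
λ*-run (u ∙ v) e k σ =
  push ◅ push ◅ stepB ◅ stepW ◅ push ◅ push ◅ push ◅ stepB ◅ push ◅ stepB ◅
  (λ*-run u e _ _ ◅◅ (push ◅ push ◅ push ◅ push ◅ stepB ◅ stepC ◅ push ◅ push ◅ push ◅ stepB ◅ push ◅ stepB ◅
  (λ*-run v e _ _ ◅◅ (push ◅ push ◅ stepB ◅ ε))))

ƛ : ∀ {N M} → Open N (suc M) → Open N M
ƛ s = λ* s ∙ con I

ƛ-run : ∀ {N M} (s : Open N (suc M)) (e : Vector (Λ N) (suc M)) σ →
        (⟦ ƛ s ⟧ (tail e) , head e ∷ σ) ≻ (⟦ s ⟧ e , σ)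
ƛ-run s e σ = push ◅ (λ*-run s e I σ ◅◅ (stepI ◅ ε))

close-all : ∀ {N} M → Open N M → Open N 0
close-all zero s = s
close-all (suc M) s = close-all M (ƛ s)

-- The stack  e (M-1) · … · e 0 · σ.
push-all : ∀ {N M} → Vector (Λ N) M → Stack N → Stack N
push-all {M = zero} e σ = σ
push-all {M = suc M} e σ = push-all (tail e) (head e ∷ σ)

close-all-run : ∀ {N} M (s : Open N M) (e : Vector (Λ N) M) σ →
                (emb (closed (close-all M s)) , push-all e σ) ≻ (⟦ s ⟧ e , σ)
close-all-run zero s e σ rewrite emb-closed s e = ε
close-all-run (suc M) s e σ = close-all-run M (ƛ s) (tail e) (head e ∷ σ) ◅◅ ƛ-run s e σ

atoms : ∀ {N} → Vector (Λ N) (suc (suc N))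
atoms zero = p
atoms (suc j) = q j

abstract-atoms : ∀ {N} → Λ N → Open N (suc (suc N))
abstract-atoms B = con B
abstract-atoms C = con C
abstract-atoms I = con I
abstract-atoms K = con K
abstract-atoms W = con W
abstract-atoms cc = con cc
abstract-atoms A = con A
abstract-atoms p = var zero
abstract-atoms (q j) = var (suc j)
abstract-atoms (t · u) = abstract-atoms t ∙ abstract-atoms u
abstract-atoms (⋀ f) = con (⋀ f)

abstract-atoms-sound : ∀ {N} (t : Λ N) → ⟦ abstract-atoms t ⟧ atoms ≡ t
abstract-atoms-sound B = refl
abstract-atoms-sound C = refl
abstract-atoms-sound I = refl
abstract-atoms-sound K = refl
abstract-atoms-sound W = refl
abstract-atoms-sound cc = refl
abstract-atoms-sound A = refl
abstract-atoms-sound p = refl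
abstract-atoms-sound (q j) = refl
abstract-atoms-sound (t · u) = cong₂ _·_ (abstract-atoms-sound t) (abstract-atoms-sound u)
abstract-atoms-sound (⋀ f) = refl

closure : ∀ {N} → Λ N → Tm N false
closure t = closed (close-all _ (abstract-atoms t))

closure-run : ∀ {N} (t : Λ N) σ → (emb (closure t) , push-all atoms σ) ≻ (t , σ)
closure-run t σ =
  subst (λ u → (emb (closure t) , push-all atoms σ) ≻ (u , σ)) (abstract-atoms-sound t)
        (close-all-run _ (abstract-atoms t) atoms σ)

record Consumes {N} (ξ : ℕ → Λ N) (σ ϖ : Stack N) (w : ℕ) : Set where
  constructor consumes
  field
    index : ℕ
    rest : Stack N
    stack≡ : σ ≡ num index ∷ rest
    run : (ξ index , rest) ≻ (p , ϖ)
    bound : suc index + weight run ≤ w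

Inversion : ∀ {N} → Λ N → (ℕ → Λ N) → Set
Inversion {N} φ ξ = ∀ {σ ϖ : Stack N} (d : (φ , σ) ≻ (p , ϖ)) → Consumes ξ σ ϖ (weight d)

⋀-inversion : ∀ {N} (f : ℕ → Tm N false) → Inversion (⋀ f) (λ n → emb (f n))
⋀-inversion f (step⋀ {n = n} {π = π} ◅ d) = consumes n π refl d ≤-refl

wrap : ∀ {N M} → Λ N → Vector (Λ N) M → Λ N
wrap {M = zero} h e = h
wrap {M = suc M} h e = C · wrap h (tail e) · head e

wrap-run : ∀ {N M} (h : Λ N) (e : Vector (Λ N) M) x σ → (wrap h e , x ∷ σ) ≻ (h , x ∷ push-all e σ)
wrap-run {M = zero} h e x σ = ε
wrap-run {M = suc M} h e x σ = push ◅ push ◅ stepC ◅ wrap-run h (tail e) x (head e ∷ σ)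

after-wrap : ∀ {N M} → Vector (Λ N) M → Stack N → Stack N
after-wrap e [] = []
after-wrap e (x ∷ σ) = x ∷ push-all e σ

wrap-inversion : ∀ {N M} (h : Λ N) (e : Vector (Λ N) M) σ ϖ (d : (wrap h e , σ) ≻ (p , ϖ)) →
                 Σ ((h , after-wrap e σ) ≻ (p , ϖ)) λ d' → weight d' ≡ weight d
wrap-inversion {M = zero} h e [] ϖ d = d , refl
wrap-inversion {M = zero} h e (x ∷ σ) ϖ d = d , refl
wrap-inversion {M = suc M} h e [] ϖ (push ◅ push ◅ (() ◅ _))
wrap-inversion {M = suc M} h e (x ∷ σ) ϖ (push ◅ push ◅ stepC ◅ d) = wrap-inversion h (tail e) (x ∷ head e ∷ σ) ϖ d

module Construction {N : ℕ} (ξ : ℕ → Λ N) where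

  φ : Λ N
  φ = wrap (⋀ (λ n → closure (ξ n))) atoms

  -- Part (a):  φ n ⋆ π ≻ ⋀ ⋆ n · push-all atoms π ≻ closure (ξ n) ⋆ … ≻ ξ n ⋆ π.
  φ-run : ∀ i → (φ · num i) ≻ₜ ξ i
  φ-run i π = push ◅ (wrap-run _ atoms (num i) π ◅◅ (step⋀ ◅ closure-run (ξ i) π))

  -- φ is inverted along ξ: unwrap, invert ⋀, then skip the closure's run.
  φ-inversion : Inversion φ ξ
  φ-inversion {[]} {ϖ} d with wrap-inversion _ atoms [] ϖ d
  ... | (() ◅ _) , _
  φ-inversion {x ∷ σ} {ϖ} d with wrap-inversion _ atoms (x ∷ σ) ϖ d
  ... | d₁ , w₁ with ⋀-inversion _ d₁
  ... | consumes n _ refl d₂ w₂ with residual (closure-run (ξ n) σ) d₂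
  ... | d₃ , w₃ = consumes n σ refl d₃ (≤-trans (≤-trans (s≤s (+-monoʳ-≤ n w₃)) w₂) (≤-reflexive w₁))

  φ-impure : ¬ Pure φ
  φ-impure (p· _ ())

-- Given φ inverted along ξ and not pure, and any ψ: a run of  t ⋆ σ  to p
-- whose calls of φ only use indices where ψ agrees with φ is simulated by
-- t' ⋆ σ' ++ ρ, where t', σ' replace φ by ψ and A by a continuation.
module Simulation {N : ℕ} (φ ψ : Λ N) (ξ : ℕ → Λ N)
                  (φ-inv : Inversion φ ξ) (φ-impure : ¬ Pure φ) where

  data _~_ : Λ N → Λ N → Set where
    φ~ψ : φ ~ ψ
    A~k : ∀ ρ → A ~ kont ρ
    B~ : B ~ B
    C~ : C ~ C
    I~ : I ~ I
    K~ : K ~ K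
    W~ : W ~ W
    cc~ : cc ~ cc
    p~ : p ~ p
    q~ : ∀ j → q j ~ q j
    ⋀~ : ∀ f → ⋀ f ~ ⋀ f
    ·~ : ∀ {t t' u u'} → t ~ t' → u ~ u' → (t · u) ~ (t' · u')

  data _≈_ : Stack N → Stack N → Set where
    []≈ : [] ≈ []
    ∷≈ : ∀ {t t' σ σ'} → t ~ t' → σ ≈ σ' → (t ∷ σ) ≈ (t' ∷ σ')

  ~-refl : ∀ t → t ~ t
  ~-refl B = B~
  ~-refl C = C~
  ~-refl I = I~
  ~-refl K = K~
  ~-refl W = W~
  ~-refl cc = cc~
  ~-refl A = A~k []
  ~-refl p = p~
  ~-refl (q j) = q~ j
  ~-refl (t · u) = ·~ (~-refl t) (~-refl u)
  ~-refl (⋀ f) = ⋀~ f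

  -- Pure terms, in particular numerals, are only related to themselves
  -- (this is where φ must not be pure).
  pure-rigid : ∀ {s t'} → s ~ t' → Pure s → t' ≡ s
  pure-rigid φ~ψ h = ⊥-elim (φ-impure h)
  pure-rigid B~ pB = refl
  pure-rigid C~ pC = refl
  pure-rigid I~ pI = refl
  pure-rigid K~ pK = refl
  pure-rigid W~ pW = refl
  pure-rigid (·~ r₁ r₂) (p· h₁ h₂) = cong₂ _·_ (pure-rigid r₁ h₁) (pure-rigid r₂ h₂)

  -- The continuation captured by cc in the original run corresponds to the
  -- one captured in the simulation, whose stack carries the extra ρ.
  kont~ : ∀ {σ σ'} → σ ≈ σ' → ∀ ρ → kont σ ~ kont (σ' ++ ρ)
  kont~ []≈ ρ = A~k ρ
  kont~ (∷≈ r rs) ρ = ·~ (·~ (·~ C~ (·~ (·~ B~ C~) B~)) r) (kont~ rs ρ)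

  Agrees : ℕ → Set
  Agrees k = ∀ i → i < k → (ψ · num i) ≻ₜ ξ i

  -- Induction on k, and on the run for steps not entering φ.  At a call of
  -- φ the argument is a numeral i < k, hence unchanged in the simulation;
  -- ψ i ≻ ξ i by agreement, and the inverted run of ξ i weighs less than k.
  -- Every other step is mimicked by the same step (A by the continuation).
  simulate : ∀ k {t t' σ σ' ϖ} (d : (t , σ) ≻ (p , ϖ)) → weight d ≤ k → Agrees k →
             t ~ t' → σ ≈ σ' → ∀ ρ → Pole (t' , σ' ++ ρ)
  simulate k d w agree φ~ψ rs ρ with φ-inv d
  simulate k d w agree φ~ψ (∷≈ r rs) ρ | consumes i σ₁ refl d' b
    with pure-rigid r (num-pure i) | ≤-trans b w
  simulate (suc k) d w agree φ~ψ (∷≈ r rs) ρ | consumes i σ₁ refl d' b | refl | b' =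
    pole-forward (push ◅ ε) (pole-backward (agree i (m+n≤o⇒m≤o (suc i) b') _)
      (simulate k d' (m+n≤o⇒n≤o i (≤-pred b')) (λ j j<k → agree j (m≤n⇒m≤1+n j<k)) (~-refl (ξ i)) rs ρ))
  simulate k ε w agree p~ rs ρ = _ , ε
  simulate k (() ◅ _) w agree p~ rs ρ
  simulate k (() ◅ _) w agree (q~ j) rs ρ
  simulate k (push ◅ d) w agree (·~ r₁ r₂) rs ρ =
    pole-backward (push ◅ ε) (simulate k d w agree r₁ (∷≈ r₂ rs) ρ)
  simulate k (stepB ◅ d) w agree B~ (∷≈ r₁ (∷≈ r₂ (∷≈ r₃ rs))) ρ =
    pole-backward (stepB ◅ ε) (simulate k d w agree r₁ (∷≈ (·~ r₂ r₃) rs) ρ)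
  simulate k (stepC ◅ d) w agree C~ (∷≈ r₁ (∷≈ r₂ (∷≈ r₃ rs))) ρ =
    pole-backward (stepC ◅ ε) (simulate k d w agree r₁ (∷≈ r₃ (∷≈ r₂ rs)) ρ)
  simulate k (stepI ◅ d) w agree I~ (∷≈ r₁ rs) ρ =
    pole-backward (stepI ◅ ε) (simulate k d w agree r₁ rs ρ)
  simulate k (stepK ◅ d) w agree K~ (∷≈ r₁ (∷≈ r₂ rs)) ρ =
    pole-backward (stepK ◅ ε) (simulate k d w agree r₁ rs ρ)
  simulate k (stepW ◅ d) w agree W~ (∷≈ r₁ (∷≈ r₂ rs)) ρ =
    pole-backward (stepW ◅ ε) (simulate k d w agree r₁ (∷≈ r₂ (∷≈ r₂ rs)) ρ)
  simulate k (stepcc ◅ d) w agree cc~ (∷≈ r₁ rs) ρ =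
    pole-backward (stepcc ◅ ε) (simulate k d w agree r₁ (∷≈ (kont~ rs ρ) rs) ρ)
  simulate k (stepA ◅ d) w agree (A~k ρ₀) (∷≈ r₁ rs) ρ =
    pole-backward (kont-run ρ₀ _ _) (simulate k d w agree r₁ []≈ ρ₀)
  simulate k (step⋀ {n = m} ◅ d) w agree (⋀~ f) (∷≈ r₁ rs) ρ with pure-rigid r₁ (num-pure m)
  ... | refl = pole-backward (step⋀ ◅ ε) (simulate k d (≤-trans (m≤n+m _ (suc m)) w) agree (~-refl (emb (f m))) rs ρ)

theorem8 : (N : ℕ) (ξ : ℕ → Λ N) →
    Σ (Λ N) λ φ →
      (∀ (i : ℕ) → (φ · num i) ≻ₜ ξ i)
      × (∀ (U : Λ N) → (U · φ) ⊩⊥ →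
          ∃ λ (k : ℕ) → ∀ (ψ : Λ N) →
            (∀ (i : ℕ) → i < k → (ψ · num i) ≻ₜ ξ i) → (U · ψ) ⊩⊥)
theorem8 N ξ = φ , φ-run , continuity
  where
  open Construction ξ
  -- k is the weight of one run of  U φ ⋆ π₀  to p
  continuity : ∀ (U : Λ N) → (U · φ) ⊩⊥ →
    ∃ λ (k : ℕ) → ∀ (ψ : Λ N) → (∀ (i : ℕ) → i < k → (ψ · num i) ≻ₜ ξ i) → (U · ψ) ⊩⊥
  continuity U Uφ⊩⊥ with Uφ⊩⊥ []
  ... | _ , d = weight d , λ ψ agree π →
    let open Simulation φ ψ ξ φ-inversion φ-impure
    in simulate (weight d) d ≤-refl agree (·~ (~-refl U) φ~ψ) []≈ π
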